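{- For every $n\ge 3$, the Cartesian product $C_n\,\square\,K_2$ (two copies $v_1v_2\cdots v_nv_1$ and $u_1u_2\cdots u_nu_1$ of the cycle $C_n$ together with the edges $v_iu_i$, $1\le i\le n$) is an AR-graph.
   Context: All graphs are finite, simple and undirected; $\mathbb{N}=\{1,2,3,\dots\}$. Let $f:E(G)\to\mathbb{N}$ be an injective edge labeling of a graph $G$. A vertex $v$ is an AR-vertex (under $f$) if, whenever $x_1,\dots,x_k$ are the labels of the $k$ edges incident on $v$, the $2^k$ sums $\sum_{i\in S}x_i$ over all subsets $S\subseteq\{1,\dots,k\}$ are pairwise distinct. An injective labeling $f$ is an AR-labeling if every vertex is an AR-vertex under $f$. A graph $G$ with $m$ edges is an AR-graph if it has an AR-labeling $f:E(G)\to\{1,2,\dots,m\}$. -}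

module Defs where

open import Data.Nat using (ℕ; zero; suc; _+_; _≤_; _%_)
open import Data.Nat.DivMod using (m%n<n)
open import Data.Fin as Fin using (Fin; toℕ; fromℕ<; _↑ˡ_; _↑ʳ_)
open import Data.Fin.Properties using (_≟_)
open import Data.Bool using (Bool; true; false)
open import Data.List using (List; []; _∷_; length; lookup; filter; map; concatMap; allFin)
open import Data.Vec using (Vec; []; _∷_)
open import Data.Product using (Σ; _×_; _,_; proj₁; proj₂)
open import Relation.Nullary.Decidable using (_⊎-dec_)
open import Relation.Binary.PropositionalEquality using (_≡_)
open import Function.Definitions using (Injective)

record Graph : Set where
  field
    V     : ℕ
    edges : List (Fin V × Fin V)

  m : ℕ
  m = length edges

  endpoints : Fin m → Fin V × Fin V
  endpoints = lookup edges

  incident : Fin V → List (Fin m)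
  incident v = filter (λ e → (proj₁ (endpoints e) ≟ v) ⊎-dec (proj₂ (endpoints e) ≟ v))
                      (allFin m)

open Graph public

subsetSum : (xs : List ℕ) → Vec Bool (length xs) → ℕ
subsetSum []       []          = 0
subsetSum (x ∷ xs) (true ∷ S)  = x + subsetSum xs S
subsetSum (x ∷ xs) (false ∷ S) = subsetSum xs S

DistinctSubsetSums : List ℕ → Set
DistinctSubsetSums xs =
  ∀ (S T : Vec Bool (length xs)) → subsetSum xs S ≡ subsetSum xs T → S ≡ T

IsARVertex : (G : Graph) → (Fin (m G) → ℕ) → Fin (V G) → Set
IsARVertex G f v = DistinctSubsetSums (map f (incident G v))

IsARLabeling : (G : Graph) → (Fin (m G) → ℕ) → Set
IsARLabeling G f = Injective _≡_ _≡_ f × (∀ v → IsARVertex G f v)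

IsARGraph : Graph → Set
IsARGraph G = Σ (Fin (m G) → ℕ) λ f →
  (∀ e → 1 ≤ f e × f e ≤ m G) × IsARLabeling G f

next : ∀ {n} → Fin n → Fin n
next {suc n} i = fromℕ< (m%n<n (suc (toℕ i)) (suc n))

-- The prism C_n □ K_2 on vertices Fin (n + n):
-- v_i = (i ↑ˡ n) (first copy), u_i = (n ↑ʳ i) (second copy).
prism : ℕ → Graph
prism n = record
  { V = n + n
  ; edges = concatMap (λ i →
        ((i ↑ˡ n) , (next i ↑ˡ n))
      ∷ ((n ↑ʳ i) , (n ↑ʳ next i))
      ∷ ((i ↑ˡ n) , (n ↑ʳ i))
      ∷ []) (allFin n)
  }

-- Number the edges 0, 1, 2, … in the order of the edge list and label edge e by e + 1, so that
-- v_i v_{i+1}, u_i u_{i+1} and v_i u_i receive 3i + 1, 3i + 2 and 3i + 3.  Every vertex has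
-- degree three, and three positive labels a < b < c have distinct subset sums as soon as
-- a + b ≠ c.  At v_j and u_j with j ≥ 1 the two rim labels are congruent to 1 + s modulo 3
-- (s = 0 for v, 1 for u) while the spoke label is divisible by 3, so a + b ≢ c (mod 3); at
-- v_0 and u_0 the wrap-around rim label 3n - 2 + s exceeds the sum of the other two.
module Submission where

open import Defs
open import Data.Nat using (ℕ; zero; suc; _+_; _*_; _≤_; _<_; _%_; z≤n; s≤s)
open import Data.Nat.Properties hiding (_≟_)
open import Data.Nat.DivMod using ([m+kn]%n≡m%n; m<n⇒m%n≡m; n%n≡0)
open import Data.Nat.Tactic.RingSolver using (solve-∀)
open import Data.Fin using (Fin; zero; suc; toℕ; _↑ˡ_; _↑ʳ_; splitAt; _≟_)
open import Data.Fin.Patterns using (0F; 1F; 2F)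
open import Data.Fin.Properties
  using (toℕ-fromℕ<; toℕ-injective; toℕ<n; ↑ˡ-injective; ↑ʳ-injective; splitAt-↑ˡ; splitAt-↑ʳ; join-splitAt)
open import Data.Bool using (Bool; true; false)
open import Data.List using (List; []; _∷_; _++_; length; lookup; map; concatMap; tabulate; allFin)
open import Data.List.Properties using (map-∘)
open import Data.List.Relation.Unary.All as All using (All; []; _∷_)
import Data.List.Relation.Unary.All.Properties as All
open import Data.List.Relation.Unary.AllPairs using (AllPairs; []; _∷_)
import Data.List.Relation.Unary.AllPairs.Properties as AllPairs
open import Data.List.Relation.Unary.Any using (here; there)
open import Data.List.Membership.Propositional using (_∈_)
open import Data.List.Relation.Binary.Sublist.Propositional using (_⊆_; []; _∷_; _∷ʳ_; minimum)
import Data.List.Relation.Binary.Sublist.Propositional.Properties as Sublist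
open import Data.Vec using (Vec; []; _∷_; head; tail)
open import Data.Product using (∃-syntax; ∃₂; _×_; _,_; proj₁; proj₂)
open import Data.Sum using (_⊎_; inj₁; inj₂)
open import Data.Empty using (⊥-elim)
open import Function using (_∘_; id)
open import Relation.Binary.Core using (Rel)
open import Relation.Binary.Definitions using (Irreflexive; Transitive)
open import Relation.Binary.PropositionalEquality
open import Relation.Nullary.Decidable using (_⊎-dec_)

private
  variable
    A B : Set

distinctSubsetSums-[] : DistinctSubsetSums []
distinctSubsetSums-[] [] [] _ = refl

distinctSubsetSums-∷ : ∀ {x xs} → DistinctSubsetSums xs →
                       (∀ S T → x + subsetSum xs S ≢ subsetSum xs T) →
                       DistinctSubsetSums (x ∷ xs)
distinctSubsetSums-∷ {x} dss new (true  ∷ S) (true  ∷ T) eq = cong (true ∷_) (dss S T (+-cancelˡ-≡ x _ _ eq))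
distinctSubsetSums-∷     dss new (true  ∷ S) (false ∷ T) eq = ⊥-elim (new S T eq)
distinctSubsetSums-∷     dss new (false ∷ S) (true  ∷ T) eq = ⊥-elim (new T S (sym eq))
distinctSubsetSums-∷     dss new (false ∷ S) (false ∷ T) eq = cong (false ∷_) (dss S T eq)

+-≢-below : ∀ {a s t} → 0 < a → t ≤ s → a + s ≢ t
+-≢-below {s = s} 0<a t≤s = >⇒≢ (≤-<-trans t≤s (m<n+m s 0<a))

distinctSubsetSums-pair : ∀ {b c} → 0 < b → b < c → DistinctSubsetSums (b ∷ c ∷ [])
distinctSubsetSums-pair {b} {c} 0<b b<c =
  distinctSubsetSums-∷ (distinctSubsetSums-∷ distinctSubsetSums-[] λ { [] [] → +-≢-below 0<c ≤-refl }) new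
  where
  0<c : 0 < c
  0<c = <-trans 0<b b<c
  new : ∀ S T → b + subsetSum (c ∷ []) S ≢ subsetSum (c ∷ []) T
  new (true  ∷ []) (true  ∷ []) = +-≢-below 0<b ≤-refl
  new (true  ∷ []) (false ∷ []) = +-≢-below 0<b z≤n
  new (false ∷ []) (true  ∷ []) = <⇒≢ (+-monoˡ-< 0 b<c)
  new (false ∷ []) (false ∷ []) = +-≢-below 0<b ≤-refl

distinctSubsetSums-triple : ∀ {a b c} → 0 < a → a < b → b < c → a + b ≢ c →
                            DistinctSubsetSums (a ∷ b ∷ c ∷ [])
distinctSubsetSums-triple {a} {b} {c} 0<a a<b b<c a+b≢c =
  distinctSubsetSums-∷ (distinctSubsetSums-pair (<-trans 0<a a<b) b<c) new
  where
  a<c : a < c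
  a<c = <-trans a<b b<c
  below : ∀ {s t} → t ≤ s → a + s ≢ t
  below = +-≢-below 0<a
  new : ∀ S T → a + subsetSum (b ∷ c ∷ []) S ≢ subsetSum (b ∷ c ∷ []) T
  new (false ∷ false ∷ []) (false ∷ false ∷ []) = below ≤-refl
  new (false ∷ false ∷ []) (true  ∷ false ∷ []) = <⇒≢ (+-monoˡ-< 0 a<b)
  new (false ∷ false ∷ []) (false ∷ true  ∷ []) = <⇒≢ (+-monoˡ-< 0 a<c)
  new (false ∷ false ∷ []) (true  ∷ true  ∷ []) = <⇒≢ (<-≤-trans (+-monoˡ-< 0 a<b) (+-monoʳ-≤ b z≤n))
  new (true  ∷ false ∷ []) (false ∷ false ∷ []) = below z≤n
  new (true  ∷ false ∷ []) (true  ∷ false ∷ []) = below ≤-refl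
  new (true  ∷ false ∷ []) (false ∷ true  ∷ []) = λ eq →
    a+b≢c (trans (cong (a +_) (sym (+-identityʳ b))) (trans eq (+-identityʳ c)))
  new (true  ∷ false ∷ []) (true  ∷ true  ∷ []) =
    <⇒≢ (subst₂ _<_ (trans (+-comm b a) (cong (a +_) (sym (+-identityʳ b))))
                    (cong (b +_) (sym (+-identityʳ c)))
                    (+-monoʳ-< b a<c))
  new (false ∷ true  ∷ []) (false ∷ false ∷ []) = below z≤n
  new (false ∷ true  ∷ []) (true  ∷ false ∷ []) = below (+-monoˡ-≤ 0 (<⇒≤ b<c))
  new (false ∷ true  ∷ []) (false ∷ true  ∷ []) = below ≤-refl
  new (false ∷ true  ∷ []) (true  ∷ true  ∷ []) = <⇒≢ (+-monoˡ-< (c + 0) a<b)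
  new (true  ∷ true  ∷ []) (false ∷ false ∷ []) = below z≤n
  new (true  ∷ true  ∷ []) (true  ∷ false ∷ []) = below (+-monoʳ-≤ b z≤n)
  new (true  ∷ true  ∷ []) (false ∷ true  ∷ []) = below (m≤n+m (c + 0) b)
  new (true  ∷ true  ∷ []) (true  ∷ true  ∷ []) = below ≤-refl

distinctSubsetSums-sorted-suc : ∀ {a b c} → AllPairs _<_ (a ∷ b ∷ c ∷ []) → suc a + suc b ≢ suc c →
                                DistinctSubsetSums (map suc (a ∷ b ∷ c ∷ []))
distinctSubsetSums-sorted-suc ((a<b ∷ _ ∷ []) ∷ (b<c ∷ []) ∷ [] ∷ []) =
  distinctSubsetSums-triple (s≤s z≤n) (s≤s a<b) (s≤s b<c)

extend : ∀ {xs ys : List ℕ} → xs ⊆ ys → Vec Bool (length xs) → Vec Bool (length ys)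
extend []           []      = []
extend (y ∷ʳ xs⊆ys) S       = false ∷ extend xs⊆ys S
extend (_ ∷ xs⊆ys)  (b ∷ S) = b ∷ extend xs⊆ys S

subsetSum-extend : ∀ {xs ys} (xs⊆ys : xs ⊆ ys) S → subsetSum ys (extend xs⊆ys S) ≡ subsetSum xs S
subsetSum-extend []             []          = refl
subsetSum-extend (y ∷ʳ xs⊆ys)   S           = subsetSum-extend xs⊆ys S
subsetSum-extend (refl ∷ xs⊆ys) (true  ∷ S) = cong (_ +_) (subsetSum-extend xs⊆ys S)
subsetSum-extend (refl ∷ xs⊆ys) (false ∷ S) = subsetSum-extend xs⊆ys S

extend-injective : ∀ {xs ys} (xs⊆ys : xs ⊆ ys) S T → extend xs⊆ys S ≡ extend xs⊆ys T → S ≡ T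
extend-injective []           []      []      _  = refl
extend-injective (y ∷ʳ xs⊆ys) S       T       eq = extend-injective xs⊆ys S T (cong tail eq)
extend-injective (_ ∷ xs⊆ys)  (b ∷ S) (c ∷ T) eq =
  cong₂ _∷_ (cong head eq) (extend-injective xs⊆ys S T (cong tail eq))

distinctSubsetSums-⊆ : ∀ {xs ys} → xs ⊆ ys → DistinctSubsetSums ys → DistinctSubsetSums xs
distinctSubsetSums-⊆ {xs} {ys} xs⊆ys dss S T eq = extend-injective xs⊆ys S T (dss _ _ (begin
  subsetSum ys (extend xs⊆ys S)  ≡⟨ subsetSum-extend xs⊆ys S ⟩
  subsetSum xs S                 ≡⟨ eq ⟩
  subsetSum xs T                 ≡⟨ subsetSum-extend xs⊆ys T ⟨
  subsetSum ys (extend xs⊆ys T)  ∎))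
  where open ≡-Reasoning

module _ {a ℓ} {A : Set a} {_<_ : Rel A ℓ}
         (<-irrefl : Irreflexive _≡_ _<_) (<-trans : Transitive _<_) where

  ∈-∷⁻-greater : ∀ {x y ys} → x < y → y ∈ x ∷ ys → y ∈ ys
  ∈-∷⁻-greater x<y (here refl)  = ⊥-elim (<-irrefl refl x<y)
  ∈-∷⁻-greater x<y (there y∈ys) = y∈ys

  All-∈-∷⁻-greater : ∀ {x xs ys} → All (x <_) xs → All (_∈ x ∷ ys) xs → All (_∈ ys) xs
  All-∈-∷⁻-greater x<xs xs⊆x∷ys = All.zipWith (λ (x<y , y∈) → ∈-∷⁻-greater x<y y∈) (x<xs , xs⊆x∷ys)

  sorted-⊆ : ∀ {xs ys} → AllPairs _<_ xs → AllPairs _<_ ys → All (_∈ ys) xs → xs ⊆ ys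
  sorted-⊆ {[]}     {ys}     _ _ _ = minimum ys
  sorted-⊆ {x ∷ xs} {y ∷ ys} (x<xs ∷ sxs) (y<ys ∷ sys) (here refl ∷ xs∈) =
    refl ∷ sorted-⊆ sxs sys (All-∈-∷⁻-greater x<xs xs∈)
  sorted-⊆ {x ∷ xs} {y ∷ ys} (x<xs ∷ sxs) (y<ys ∷ sys) (there x∈ys ∷ xs∈) =
    y ∷ʳ sorted-⊆ (x<xs ∷ sxs) sys (x∈ys ∷ All-∈-∷⁻-greater y<xs xs∈)
    where
    y<xs : All (y <_) xs
    y<xs = All.map (<-trans (All.lookup y<ys x∈ys)) x<xs

lookup-tabulate-++ : ∀ {k} (f : Fin k → A) ys (e : Fin (length (tabulate f ++ ys))) →
                     (∃[ r ] toℕ e ≡ toℕ r × lookup (tabulate f ++ ys) e ≡ f r)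
                   ⊎ (∃[ e′ ] toℕ e ≡ k + toℕ e′ × lookup (tabulate f ++ ys) e ≡ lookup ys e′)
lookup-tabulate-++ {k = zero}  f ys e        = inj₂ (e , refl , refl)
lookup-tabulate-++ {k = suc k} f ys 0F       = inj₁ (0F , refl , refl)
lookup-tabulate-++ {k = suc k} f ys (suc e) with lookup-tabulate-++ (f ∘ suc) ys e
... | inj₁ (r , e≡r , eq)     = inj₁ (suc r , cong suc e≡r , eq)
... | inj₂ (e′ , e≡k+e′ , eq) = inj₂ (e′ , cong suc e≡k+e′ , eq)

lookup-concatMap-tabulate : ∀ {n k} (h : Fin n → B) (t : B → Fin k → A)
                            (e : Fin (length (concatMap (tabulate ∘ t) (tabulate h)))) →
                            ∃₂ λ i r → toℕ e ≡ toℕ i * k + toℕ r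
                                     × lookup (concatMap (tabulate ∘ t) (tabulate h)) e ≡ t (h i) r
lookup-concatMap-tabulate {n = zero}          h t ()
lookup-concatMap-tabulate {n = suc n} {k = k} h t e
  with lookup-tabulate-++ (t (h 0F)) (concatMap (tabulate ∘ t) (tabulate (h ∘ suc))) e
... | inj₁ (r , e≡r , eq)     = 0F , r , e≡r , eq
... | inj₂ (e′ , e≡k+e′ , eq) with lookup-concatMap-tabulate (h ∘ suc) t e′
...   | i , r , e′≡i*k+r , eq′ = suc i , r , e≡[1+i]*k+r , trans eq eq′
  where
  e≡[1+i]*k+r : toℕ e ≡ k + toℕ i * k + toℕ r
  e≡[1+i]*k+r = trans e≡k+e′ (trans (cong (k +_) e′≡i*k+r) (sym (+-assoc k (toℕ i * k) (toℕ r))))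

toℕ-next : ∀ {n} (i : Fin n) → toℕ (next i) ≡ suc (toℕ i) ⊎ (suc (toℕ i) ≡ n × toℕ (next i) ≡ 0)
toℕ-next {suc n} i with m≤n⇒m<n∨m≡n (toℕ<n i)
... | inj₁ 1+i<n = inj₁ (trans (toℕ-fromℕ< _) (m<n⇒m%n≡m 1+i<n))
... | inj₂ 1+i≡n = inj₂ (1+i≡n , trans (toℕ-fromℕ< _) (trans (cong (_% suc n) 1+i≡n) (n%n≡0 (suc n))))

↑ˡ≢↑ʳ : ∀ {m n} (i : Fin m) (j : Fin n) → i ↑ˡ n ≢ m ↑ʳ j
↑ˡ≢↑ʳ {m} {n} i j eq with trans (sym (splitAt-↑ˡ m i n)) (trans (cong (splitAt m) eq) (splitAt-↑ʳ m n j))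
... | ()

IsEndpoint : A → A × A → Set
IsEndpoint v uw = proj₁ uw ≡ v ⊎ proj₂ uw ≡ v

module _ (G : Graph) where

  incident-isEndpoint : ∀ v → All (λ e → IsEndpoint v (endpoints G e)) (incident G v)
  incident-isEndpoint v =
    All.all-filter (λ e → (proj₁ (endpoints G e) ≟ v) ⊎-dec (proj₂ (endpoints G e) ≟ v)) (allFin (m G))

  incident-sorted : ∀ v → AllPairs _<_ (map toℕ (incident G v))
  incident-sorted v = AllPairs.map⁺ (AllPairs.filter⁺ _ (AllPairs.tabulate⁺-< id))

  edgeNumbering : Fin (m G) → ℕ
  edgeNumbering e = suc (toℕ e)

  -- incident G v lists edges in increasing order, so an increasing L containing all their
  -- numbers contains them as a sublist, and sublists inherit distinct subset sums.
  isARVertex-edgeNumbering : ∀ v {L} → AllPairs _<_ L → DistinctSubsetSums (map suc L) →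
                             (∀ e → IsEndpoint v (endpoints G e) → toℕ e ∈ L) →
                             IsARVertex G edgeNumbering v
  isARVertex-edgeNumbering v {L} sortedL dssL incident∈L =
    subst DistinctSubsetSums (sym (map-∘ (incident G v)))
      (distinctSubsetSums-⊆ (Sublist.map⁺ suc incident⊆L) dssL)
    where
    incident⊆L : map toℕ (incident G v) ⊆ L
    incident⊆L = sorted-⊆ <-irrefl <-trans (incident-sorted v) sortedL
                   (All.map⁺ (All.map (incident∈L _) (incident-isEndpoint v)))

  isARGraph-edgeNumbering : (∀ v → IsARVertex G edgeNumbering v) → IsARGraph G
  isARGraph-edgeNumbering isAR =
    edgeNumbering , (λ e → s≤s z≤n , toℕ<n e) , (toℕ-injective ∘ suc-injective) , isAR

module Prism (k : ℕ) where

  N : ℕ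
  N = 3 + k

  copy : Fin 2 → Fin N → Fin (N + N)
  copy 0F j = j ↑ˡ N
  copy 1F j = N ↑ʳ j

  copy-injective : ∀ {s s′ i j} → copy s i ≡ copy s′ j → s ≡ s′ × i ≡ j
  copy-injective {0F} {0F} {i} {j} eq = refl , ↑ˡ-injective N i j eq
  copy-injective {0F} {1F} {i} {j} eq = ⊥-elim (↑ˡ≢↑ʳ i j eq)
  copy-injective {1F} {0F} {i} {j} eq = ⊥-elim (↑ˡ≢↑ʳ j i (sym eq))
  copy-injective {1F} {1F} {i} {j} eq = refl , ↑ʳ-injective N i j eq

  copy-surjective : ∀ v → ∃₂ λ s j → copy s j ≡ v
  copy-surjective v with splitAt N v | join-splitAt N N v
  ... | inj₁ j | eq = 0F , j , eq
  ... | inj₂ j | eq = 1F , j , eq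

  rimEdge : Fin 2 → Fin N → Fin (N + N) × Fin (N + N)
  rimEdge s i = copy s i , copy s (next i)

  spokeEdge : Fin N → Fin (N + N) × Fin (N + N)
  spokeEdge i = copy 0F i , copy 1F i

  prismEdge : Fin N → Fin 3 → Fin (N + N) × Fin (N + N)
  prismEdge i 0F = rimEdge 0F i
  prismEdge i 1F = rimEdge 1F i
  prismEdge i 2F = spokeEdge i

  endpoints-prism : ∀ e → ∃₂ λ i r → toℕ e ≡ toℕ i * 3 + toℕ r × endpoints (prism N) e ≡ prismEdge i r
  endpoints-prism = lookup-concatMap-tabulate id prismEdge

  -- the numbers of the three edges at copy s of vertex j, in increasing order
  incidentEdges : Fin 2 → ℕ → List ℕ
  incidentEdges s zero    = toℕ s ∷ 2 ∷ suc (suc k) * 3 + toℕ s ∷ []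
  incidentEdges s (suc j) = j * 3 + toℕ s ∷ suc j * 3 + toℕ s ∷ suc j * 3 + 2 ∷ []

  incidentEdges-sorted : ∀ s j → AllPairs _<_ (incidentEdges s j)
  incidentEdges-sorted 0F zero =
    (s≤s z≤n ∷ s≤s z≤n ∷ []) ∷ (s≤s (s≤s (s≤s z≤n)) ∷ []) ∷ [] ∷ []
  incidentEdges-sorted 1F zero =
    (s≤s (s≤s z≤n) ∷ s≤s (s≤s z≤n) ∷ []) ∷ (s≤s (s≤s (s≤s z≤n)) ∷ []) ∷ [] ∷ []
  incidentEdges-sorted s (suc j) = (a<b ∷ <-trans a<b b<c ∷ []) ∷ (b<c ∷ []) ∷ [] ∷ []
    where
    a<b : j * 3 + toℕ s < 3 + (j * 3 + toℕ s)
    a<b = s≤s (m≤n+m _ 2)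
    b<c : 3 + (j * 3 + toℕ s) < 3 + (j * 3 + 2)
    b<c = +-monoʳ-< 3 (+-monoʳ-< (j * 3) (toℕ<n s))

  rimLabels≢spokeLabel : ∀ s j → suc (j * 3 + toℕ s) + suc (3 + (j * 3 + toℕ s)) ≢ suc (3 + (j * 3 + 2))
  rimLabels≢spokeLabel s j eq = residue≢0 s (begin
    (2 * toℕ s + 2) % 3                            ≡⟨ [m+kn]%n≡m%n (2 * toℕ s + 2) (2 * j + 1) 3 ⟨
    (2 * toℕ s + 2 + (2 * j + 1) * 3) % 3          ≡⟨ cong (_% 3) (rimLabels (toℕ s) j) ⟨
    (suc (j * 3 + toℕ s) + suc (3 + (j * 3 + toℕ s))) % 3 ≡⟨ cong (_% 3) (trans eq (spokeLabel j)) ⟩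
    (0 + (j + 2) * 3) % 3                          ≡⟨ [m+kn]%n≡m%n 0 (j + 2) 3 ⟩
    0                                              ∎)
    where
    open ≡-Reasoning
    rimLabels : ∀ s j → suc (j * 3 + s) + suc (3 + (j * 3 + s)) ≡ 2 * s + 2 + (2 * j + 1) * 3
    rimLabels = solve-∀
    spokeLabel : ∀ j → suc (3 + (j * 3 + 2)) ≡ 0 + (j + 2) * 3
    spokeLabel = solve-∀
    residue≢0 : ∀ (s : Fin 2) → (2 * toℕ s + 2) % 3 ≢ 0
    residue≢0 0F ()
    residue≢0 1F ()

  incidentLabels-distinct : ∀ s j → DistinctSubsetSums (map suc (incidentEdges s j))
  incidentLabels-distinct 0F zero    = distinctSubsetSums-sorted-suc (incidentEdges-sorted 0F zero) λ ()
  incidentLabels-distinct 1F zero    = distinctSubsetSums-sorted-suc (incidentEdges-sorted 1F zero) λ ()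
  incidentLabels-distinct s  (suc j) =
    distinctSubsetSums-sorted-suc (incidentEdges-sorted s (suc j)) (rimLabels≢spokeLabel s j)

  rim-∈ : ∀ s j → j * 3 + toℕ s ∈ incidentEdges s j
  rim-∈ s zero    = here refl
  rim-∈ s (suc j) = there (here refl)

  rim-∈-next : ∀ s (i : Fin N) → toℕ i * 3 + toℕ s ∈ incidentEdges s (toℕ (next i))
  rim-∈-next s i with toℕ-next i
  ... | inj₁ next≡1+i rewrite next≡1+i = here refl
  ... | inj₂ (1+i≡N , next≡0) rewrite next≡0 | suc-injective 1+i≡N = there (there (here refl))

  spoke-∈ : ∀ s j → j * 3 + 2 ∈ incidentEdges s j
  spoke-∈ s zero    = there (here refl)
  spoke-∈ s (suc j) = there (there (here refl))

  rimEdge-∈ : ∀ {s′ j} s i → IsEndpoint (copy s′ j) (rimEdge s i) →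
              toℕ i * 3 + toℕ s ∈ incidentEdges s′ (toℕ j)
  rimEdge-∈ {s′} {j} s i (inj₁ eq) with copy-injective {s} {s′} {i} {j} eq
  ... | refl , refl = rim-∈ s (toℕ i)
  rimEdge-∈ {s′} {j} s i (inj₂ eq) with copy-injective {s} {s′} {next i} {j} eq
  ... | refl , refl = rim-∈-next s i

  prismEdge-∈ : ∀ {s j} i r → IsEndpoint (copy s j) (prismEdge i r) →
                toℕ i * 3 + toℕ r ∈ incidentEdges s (toℕ j)
  prismEdge-∈ i 0F = rimEdge-∈ 0F i
  prismEdge-∈ i 1F = rimEdge-∈ 1F i
  prismEdge-∈ {s} {j} i 2F (inj₁ eq) with copy-injective {0F} {s} {i} {j} eq
  ... | refl , refl = spoke-∈ 0F (toℕ i)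
  prismEdge-∈ {s} {j} i 2F (inj₂ eq) with copy-injective {1F} {s} {i} {j} eq
  ... | refl , refl = spoke-∈ 1F (toℕ i)

  incident-∈-incidentEdges : ∀ s j e → IsEndpoint (copy s j) (endpoints (prism N) e) →
                             toℕ e ∈ incidentEdges s (toℕ j)
  incident-∈-incidentEdges s j e isEndpoint with endpoints-prism e
  ... | i , r , e≡ , endpoints≡ rewrite e≡ =
    prismEdge-∈ i r (subst (IsEndpoint (copy s j)) endpoints≡ isEndpoint)

  isARVertex : ∀ v → IsARVertex (prism N) (edgeNumbering (prism N)) v
  isARVertex v with copy-surjective v
  ... | s , j , refl = isARVertex-edgeNumbering (prism N) (copy s j)
                         (incidentEdges-sorted s (toℕ j)) (incidentLabels-distinct s (toℕ j))
                         (incident-∈-incidentEdges s j)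

mainTheorem20 : ∀ (n : ℕ) → 3 ≤ n → IsARGraph (prism n)
mainTheorem20 (suc (suc (suc k))) _ = isARGraph-edgeNumbering (prism (3 + k)) (Prism.isARVertex k)
mainTheorem20 (suc (suc zero)) (s≤s (s≤s ()))
mainTheorem20 (suc zero)       (s≤s ())
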